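{- Let $G=G_1\otimes G_2$ where $G_1$ and $G_2$ are arbitrary (vertex-disjoint) graphs, and let $I_s,I_t$ be independent sets of $G$. Then there is a reconfiguration sequence from $I_s$ to $I_t$ of length at most $2$.
   Context: For vertex-disjoint graphs $G_1=(V_1,E_1)$ and $G_2=(V_2,E_2)$, the join $G_1\otimes G_2$ is the graph with vertex set $V_1\cup V_2$ and edge set $E_1\cup E_2\cup\{v_1v_2: v_1\in V_1, v_2\in V_2\}$. A reconfiguration sequence from $I_s$ to $I_t$ of length $\ell$ is a sequence $I_s=I_0,I_1,\dots,I_\ell=I_t$ of independent sets of $G$ such that the induced subgraph $G[I_{i-1}\triangle I_i]$ is connected for every $i\in\{1,\dots,\ell\}$. -}

module Defs where

open import Level using (Level; 0ℓ)
open import Data.Nat using (ℕ; zero; suc; _≤_)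
open import Data.Fin using (Fin)
open import Data.Bool using (Bool; true; false; _xor_)
open import Data.Sum using (_⊎_; inj₁; inj₂)
open import Data.Unit using (⊤)
open import Data.Empty using (⊥)
open import Relation.Nullary using (¬_)
open import Relation.Binary.PropositionalEquality using (_≡_)

record Graph (V : Set) : Set₁ where
  field
    Adj   : V → V → Set
    sym   : ∀ {u v} → Adj u v → Adj v u
    irrefl : ∀ {v} → ¬ Adj v v
open Graph public

-- A finite graph with a nonempty vertex set {0,…,n}.
FinGraph : ℕ → Set₁
FinGraph n = Graph (Fin (suc n))

VSet : Set → Set
VSet V = V → Bool

JoinAdj : ∀ {V₁ V₂} → Graph V₁ → Graph V₂ → V₁ ⊎ V₂ → V₁ ⊎ V₂ → Set
JoinAdj G₁ G₂ (inj₁ u) (inj₁ v) = Adj G₁ u v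
JoinAdj G₁ G₂ (inj₂ u) (inj₂ v) = Adj G₂ u v
JoinAdj G₁ G₂ (inj₁ u) (inj₂ v) = ⊤
JoinAdj G₁ G₂ (inj₂ u) (inj₁ v) = ⊤

join-sym : ∀ {V₁ V₂} (G₁ : Graph V₁) (G₂ : Graph V₂) {u v} →
           JoinAdj G₁ G₂ u v → JoinAdj G₁ G₂ v u
join-sym G₁ G₂ {inj₁ u} {inj₁ v} a = sym G₁ a
join-sym G₁ G₂ {inj₂ u} {inj₂ v} a = sym G₂ a
join-sym G₁ G₂ {inj₁ u} {inj₂ v} a = a
join-sym G₁ G₂ {inj₂ u} {inj₁ v} a = a

join-irrefl : ∀ {V₁ V₂} (G₁ : Graph V₁) (G₂ : Graph V₂) {v} →
              ¬ JoinAdj G₁ G₂ v v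
join-irrefl G₁ G₂ {inj₁ v} = irrefl G₁
join-irrefl G₁ G₂ {inj₂ v} = irrefl G₂

_⊗_ : ∀ {V₁ V₂} → Graph V₁ → Graph V₂ → Graph (V₁ ⊎ V₂)
G₁ ⊗ G₂ = record { Adj = JoinAdj G₁ G₂ ; sym = λ {u} {v} → join-sym G₁ G₂ {u} {v} ; irrefl = λ {v} → join-irrefl G₁ G₂ {v} }

Independent : ∀ {V} → Graph V → VSet V → Set
Independent G I = ∀ u v → I u ≡ true → I v ≡ true → ¬ Adj G u v

_△_ : ∀ {V} → VSet V → VSet V → VSet V
(A △ B) v = A v xor B v

data WalkIn {V : Set} (G : Graph V) (S : VSet V) : V → V → Set where
  here : ∀ {v} → S v ≡ true → WalkIn G S v v
  step : ∀ {u w v} → S u ≡ true → Adj G u w → WalkIn G S w v → WalkIn G S u v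

ConnectedInduced : ∀ {V} → Graph V → VSet V → Set
ConnectedInduced G S = ∀ u v → S u ≡ true → S v ≡ true → WalkIn G S u v

data ReconfSeq {V : Set} (G : Graph V) : VSet V → VSet V → ℕ → Set where
  done : ∀ {I} → Independent G I → ReconfSeq G I I 0
  move : ∀ {I J K ℓ} → Independent G I → ConnectedInduced G (I △ J) →
         ReconfSeq G J K ℓ → ReconfSeq G I K (suc ℓ)

module Submission where

-- Every vertex of V₁ is adjacent to every vertex of V₂, so an independent set of G₁ ⊗ G₂ lies
-- inside one side, and any vertex set meeting both sides induces a connected subgraph. If Iₛ and
-- Iₜ are nonempty and on opposite sides, Iₛ △ Iₜ = Iₛ ∪ Iₜ meets both sides: one step suffices.
-- Otherwise both lie in one side, and a vertex w of the other side is adjacent to all of Iₛ ∪ Iₜ;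
-- the route Iₛ → {w} → Iₜ has the stars Iₛ ∪ {w} and {w} ∪ Iₜ as symmetric differences.

open import Defs hiding (sym)
open import Data.Nat using (ℕ; suc; _≤_; s≤s; z≤n)
open import Data.Nat.Properties using (≤-refl)
open import Data.Fin using (Fin; zero)
open import Data.Fin.Properties using (any?; _≟_)
open import Data.Sum using (_⊎_; inj₁; inj₂)
open import Data.Sum.Properties using (≡-dec)
open import Data.Product using (Σ; ∃; _×_; _,_)
open import Data.Bool using (Bool; true; false)
open import Data.Bool.Properties using (xor-comm; xor-identityʳ; ¬-not) renaming (_≟_ to _≟ᵇ_)
open import Data.Unit using (tt)
open import Relation.Nullary using (yes; no; does; contradiction)
open import Relation.Binary.Definitions using (DecidableEquality)
open import Relation.Binary.PropositionalEquality using (_≡_; refl; sym; trans)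

AdjacentToAll : ∀ {V} → Graph V → V → VSet V → Set
AdjacentToAll G h I = ∀ x → I x ≡ true → Adj G h x

module _ {V : Set} (G : Graph V) where

  star-connected : ∀ {S} h → S h ≡ true → (∀ x → S x ≡ true → x ≡ h ⊎ Adj G h x) →
                   ConnectedInduced G S
  star-connected h h∈S star u v u∈S v∈S with star u u∈S | star v v∈S
  ... | inj₁ refl | inj₁ refl = here h∈S
  ... | inj₁ refl | inj₂ hv   = step h∈S hv (here v∈S)
  ... | inj₂ hu   | inj₁ refl = step u∈S (Graph.sym G hu) (here h∈S)
  ... | inj₂ hu   | inj₂ hv   = step u∈S (Graph.sym G hu) (step h∈S hv (here v∈S))

  △-comm : ∀ (A B : VSet V) v → (A △ B) v ≡ (B △ A) v
  △-comm A B v = xor-comm (A v) (B v)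

  ∈-△-of-adjacent : ∀ {I J u v} → Independent G I → Independent G J →
                    I u ≡ true → J v ≡ true → Adj G u v →
                    (I △ J) u ≡ true × (I △ J) v ≡ true
  ∈-△-of-adjacent {I} {J} {u} {v} indI indJ u∈I v∈J uv =
    u∈I△J , v∈I△J
    where
    u∉J : J u ≡ false
    u∉J = ¬-not λ u∈J → indJ u v u∈J v∈J uv
    v∉I : I v ≡ false
    v∉I = ¬-not λ v∈I → indI u v u∈I v∈I uv
    u∈I△J : (I △ J) u ≡ true
    u∈I△J rewrite u∈I | u∉J = refl
    v∈I△J : (I △ J) v ≡ true
    v∈I△J rewrite v∉I | v∈J = refl

  module _ (_≟_ : DecidableEquality V) where

    ⁅_⁆ : V → VSet V
    ⁅ h ⁆ v = does (v ≟ h)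

    ∈⁅⁆⇒≡ : ∀ {h v} → ⁅ h ⁆ v ≡ true → v ≡ h
    ∈⁅⁆⇒≡ {h} {v} v∈⁅h⁆ with v ≟ h
    ... | yes v≡h = v≡h
    ... | no _    = contradiction v∈⁅h⁆ λ ()

    ⁅⁆-independent : ∀ h → Independent G ⁅ h ⁆
    ⁅⁆-independent h u v u∈⁅h⁆ v∈⁅h⁆
      with refl ← ∈⁅⁆⇒≡ u∈⁅h⁆ | refl ← ∈⁅⁆⇒≡ v∈⁅h⁆ = irrefl G

    -- h ∉ I, since h would be adjacent to itself; so I △ ⁅ h ⁆ = I ∪ {h}, a star centred at h.
    h∈△⁅h⁆ : ∀ {h I} → AdjacentToAll G h I → (I △ ⁅ h ⁆) h ≡ true
    h∈△⁅h⁆ {h} {I} h~I with h ≟ h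
    ... | no h≢h = contradiction refl h≢h
    ... | yes _ rewrite ¬-not {I h} λ h∈I → irrefl G (h~I h h∈I) = refl

    ∈△⁅⁆⇒star : ∀ {h I} → AdjacentToAll G h I →
                ∀ x → (I △ ⁅ h ⁆) x ≡ true → x ≡ h ⊎ Adj G h x
    ∈△⁅⁆⇒star {h} {I} h~I x x∈ with x ≟ h
    ... | yes x≡h = inj₁ x≡h
    ... | no _    = inj₂ (h~I x (trans (sym (xor-identityʳ (I x))) x∈))

    reconf-via-adjacent-vertex : ∀ h {I J} → Independent G I → Independent G J →
                                 AdjacentToAll G h I → AdjacentToAll G h J →
                                 ReconfSeq G I J 2
    reconf-via-adjacent-vertex h {I} {J} indI indJ h~I h~J =
      move indI (star-connected h (h∈△⁅h⁆ h~I) (∈△⁅⁆⇒star h~I))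
        (move (⁅⁆-independent h) ⁅h⁆△J-connected (done indJ))
      where
      ⁅h⁆△J-connected : ConnectedInduced G (⁅ h ⁆ △ J)
      ⁅h⁆△J-connected =
        star-connected h (trans (△-comm ⁅ h ⁆ J h) (h∈△⁅h⁆ h~J))
          λ x x∈ → ∈△⁅⁆⇒star h~J x (trans (△-comm J ⁅ h ⁆ x) x∈)

module _ {V₁ V₂ : Set} (G₁ : Graph V₁) (G₂ : Graph V₂) where

  Avoids₁ Avoids₂ : VSet (V₁ ⊎ V₂) → Set
  Avoids₁ I = ∀ a → I (inj₁ a) ≡ false
  Avoids₂ I = ∀ b → I (inj₂ b) ≡ false

  join-connected : ∀ {S a b} → S (inj₁ a) ≡ true → S (inj₂ b) ≡ true →
                   ConnectedInduced (G₁ ⊗ G₂) S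
  join-connected a∈S b∈S (inj₁ _) (inj₁ _) u∈S v∈S = step u∈S tt (step b∈S tt (here v∈S))
  join-connected a∈S b∈S (inj₁ _) (inj₂ _) u∈S v∈S = step u∈S tt (here v∈S)
  join-connected a∈S b∈S (inj₂ _) (inj₁ _) u∈S v∈S = step u∈S tt (here v∈S)
  join-connected a∈S b∈S (inj₂ _) (inj₂ _) u∈S v∈S = step u∈S tt (step a∈S tt (here v∈S))

  avoids₂⇒inj₂-adjacentToAll : ∀ {I} → Avoids₂ I → ∀ b → AdjacentToAll (G₁ ⊗ G₂) (inj₂ b) I
  avoids₂⇒inj₂-adjacentToAll I⊆V₁ b (inj₁ _)  _  = tt
  avoids₂⇒inj₂-adjacentToAll I⊆V₁ b (inj₂ b′) b′∈I = contradiction (trans (sym b′∈I) (I⊆V₁ b′)) λ ()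

  avoids₁⇒inj₁-adjacentToAll : ∀ {I} → Avoids₁ I → ∀ a → AdjacentToAll (G₁ ⊗ G₂) (inj₁ a) I
  avoids₁⇒inj₁-adjacentToAll I⊆V₂ a (inj₂ _)  _  = tt
  avoids₁⇒inj₁-adjacentToAll I⊆V₂ a (inj₁ a′) a′∈I = contradiction (trans (sym a′∈I) (I⊆V₂ a′)) λ ()

  meets₂⇒avoids₁ : ∀ {I b} → Independent (G₁ ⊗ G₂) I → I (inj₂ b) ≡ true → Avoids₁ I
  meets₂⇒avoids₁ {b = b} indI b∈I a = ¬-not λ a∈I → indI (inj₁ a) (inj₂ b) a∈I b∈I tt

  reconf-across : ∀ {I J a b} → Independent (G₁ ⊗ G₂) I → Independent (G₁ ⊗ G₂) J →
                  (I (inj₁ a) ≡ true × J (inj₂ b) ≡ true) ⊎ (I (inj₂ b) ≡ true × J (inj₁ a) ≡ true) →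
                  ReconfSeq (G₁ ⊗ G₂) I J 1
  reconf-across indI indJ (inj₁ (a∈I , b∈J))
    with a∈△ , b∈△ ← ∈-△-of-adjacent (G₁ ⊗ G₂) indI indJ a∈I b∈J tt =
    move indI (join-connected a∈△ b∈△) (done indJ)
  reconf-across indI indJ (inj₂ (b∈I , a∈J))
    with b∈△ , a∈△ ← ∈-△-of-adjacent (G₁ ⊗ G₂) indI indJ b∈I a∈J tt =
    move indI (join-connected a∈△ b∈△) (done indJ)

  module _ (_≟₁_ : DecidableEquality V₁) (_≟₂_ : DecidableEquality V₂) (a₀ : V₁) (b₀ : V₂) where

    reconf-within₁ : ∀ {I J} → Independent (G₁ ⊗ G₂) I → Independent (G₁ ⊗ G₂) J →
                     Avoids₂ I → Avoids₂ J → ReconfSeq (G₁ ⊗ G₂) I J 2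
    reconf-within₁ indI indJ I⊆V₁ J⊆V₁ =
      reconf-via-adjacent-vertex (G₁ ⊗ G₂) (≡-dec _≟₁_ _≟₂_) (inj₂ b₀) indI indJ
        (avoids₂⇒inj₂-adjacentToAll I⊆V₁ b₀) (avoids₂⇒inj₂-adjacentToAll J⊆V₁ b₀)

    reconf-within₂ : ∀ {I J} → Independent (G₁ ⊗ G₂) I → Independent (G₁ ⊗ G₂) J →
                     Avoids₁ I → Avoids₁ J → ReconfSeq (G₁ ⊗ G₂) I J 2
    reconf-within₂ indI indJ I⊆V₂ J⊆V₂ =
      reconf-via-adjacent-vertex (G₁ ⊗ G₂) (≡-dec _≟₁_ _≟₂_) (inj₁ a₀) indI indJ
        (avoids₁⇒inj₁-adjacentToAll I⊆V₂ a₀) (avoids₁⇒inj₁-adjacentToAll J⊆V₂ a₀)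

    module _ (avoids₁⊎meets₁ : ∀ I → Avoids₁ I ⊎ ∃ λ a → I (inj₁ a) ≡ true)
             (avoids₂⊎meets₂ : ∀ I → Avoids₂ I ⊎ ∃ λ b → I (inj₂ b) ≡ true) where

      join-reconf-≤2 : ∀ {I J} → Independent (G₁ ⊗ G₂) I → Independent (G₁ ⊗ G₂) J →
                       Σ ℕ λ ℓ → ℓ ≤ 2 × ReconfSeq (G₁ ⊗ G₂) I J ℓ
      join-reconf-≤2 {I} {J} indI indJ with avoids₂⊎meets₂ I | avoids₂⊎meets₂ J
      ... | inj₁ I⊆V₁ | inj₁ J⊆V₁ = 2 , ≤-refl , reconf-within₁ indI indJ I⊆V₁ J⊆V₁
      ... | inj₂ (_ , b∈I) | inj₂ (_ , b∈J) =
        2 , ≤-refl , reconf-within₂ indI indJ (meets₂⇒avoids₁ indI b∈I) (meets₂⇒avoids₁ indJ b∈J)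
      ... | inj₂ (_ , b∈I) | inj₁ _ with avoids₁⊎meets₁ J
      ...   | inj₁ J⊆V₂ = 2 , ≤-refl , reconf-within₂ indI indJ (meets₂⇒avoids₁ indI b∈I) J⊆V₂
      ...   | inj₂ (_ , a∈J) = 1 , s≤s z≤n , reconf-across indI indJ (inj₂ (b∈I , a∈J))
      join-reconf-≤2 {I} {J} indI indJ | inj₁ _ | inj₂ (_ , b∈J) with avoids₁⊎meets₁ I
      ...   | inj₁ I⊆V₂ = 2 , ≤-refl , reconf-within₂ indI indJ I⊆V₂ (meets₂⇒avoids₁ indJ b∈J)
      ...   | inj₂ (_ , a∈I) = 1 , s≤s z≤n , reconf-across indI indJ (inj₁ (a∈I , b∈J))

false-everywhere⊎true-somewhere : ∀ {n} (f : Fin n → Bool) →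
                                  (∀ i → f i ≡ false) ⊎ ∃ λ i → f i ≡ true
false-everywhere⊎true-somewhere f with any? (λ i → f i ≟ᵇ true)
... | yes found = inj₂ found
... | no none   = inj₁ λ i → ¬-not λ fi → none (i , fi)

lemma25 : (n₁ n₂ : ℕ) (G₁ : FinGraph n₁) (G₂ : FinGraph n₂)
          (Iₛ Iₜ : VSet (Fin (suc n₁) ⊎ Fin (suc n₂))) →
          Independent (G₁ ⊗ G₂) Iₛ → Independent (G₁ ⊗ G₂) Iₜ →
          Σ ℕ (λ ℓ → ℓ ≤ 2 × ReconfSeq (G₁ ⊗ G₂) Iₛ Iₜ ℓ)
lemma25 n₁ n₂ G₁ G₂ Iₛ Iₜ =
  join-reconf-≤2 G₁ G₂ _≟_ _≟_ zero zero
    (λ I → false-everywhere⊎true-somewhere (λ a → I (inj₁ a)))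
    (λ I → false-everywhere⊎true-somewhere (λ b → I (inj₂ b)))
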